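{- Let $l<\omega$ and $c:[\omega_1]^2\rightarrow l$. Suppose $J$ is a normal ideal on $\omega_1$, $i,j<l$, and $\langle A,B\rangle$ is a pair of $J$-positive sets that is $\langle i,j\rangle$-saturated over $J$. Then $\langle J\restriction A, J\restriction B\rangle$ is an $\langle i,j\rangle$-saturated pair of normal ideals.
   Context: $c$ colors unordered pairs, and $c(\alpha,\beta)$ denotes $c(\{\alpha,\beta\})$. For an ideal $J$ on $\omega_1$: $J^+$ is the family of $J$-positive sets, $J^*$ the dual filter, $J\restriction A=\{X\subseteq\omega_1: A\cap X\in J\}$; "$(\forall^J\alpha)\varphi(\alpha)$" means $\{\alpha:\varphi(\alpha)\}\in J^*$ and "$(\exists^J\alpha)\varphi(\alpha)$" means $\{\alpha:\varphi(\alpha)\}\notin J$. A pair $\langle C,D\rangle$ of $J$-positive sets is weakly $\langle i,j\rangle$-saturated over $J$ if $(\exists^J\alpha\in C)(\exists^J\beta\in D)[c(\alpha,\beta)=i]$ and $(\exists^J\beta\in D)(\exists^J\alpha\in C)[c(\alpha,\beta)=j]$. A pair $\langle A,B\rangle$ of $J$-positive sets is $\langle i,j\rangle$-saturated over $J$ if every pair $\langle C,D\rangle$ of $J$-positive sets with $C\subseteq A$, $D\subseteq B$ is weakly $\langle i,j\rangle$-saturated over $J$. A pair $\langle J_0,J_1\rangle$ of normal ideals on $\omega_1$ is $\langle i,j\rangle$-saturated if for all normal ideals $I_0\supseteq J_0$ and $I_1\supseteq J_1$ on $\omega_1$ we have $(\forall^{I_0}\alpha<\omega_1)(\exists^{I_1}\beta<\omega_1)[c(\alpha,\beta)=i]$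 and $(\forall^{I_1}\beta<\omega_1)(\exists^{I_0}\alpha<\omega_1)[c(\alpha,\beta)=j]$. -}

module Defs where

open import Data.Nat using (ℕ)
open import Data.Fin using (Fin)
open import Data.Product using (Σ; _×_)
open import Data.Sum using (_⊎_)
open import Data.Unit using (⊤)
open import Data.Empty using (⊥)
open import Relation.Nullary using (¬_)
open import Relation.Binary.PropositionalEquality using (_≡_)
open import Induction.WellFounded using (WellFounded)
open import Function.Definitions using (Injective)

-- Law of excluded middle (the paper works in ZFC, i.e. classically).
ExcludedMiddle : Set₁
ExcludedMiddle = (P : Set) → P ⊎ ¬ P

Countable : Set → Set
Countable X = Σ (X → ℕ) (λ f → Injective _≡_ _≡_ f)

record IsOmega1 (Ω : Set) (_<_ : Ω → Ω → Set) : Set₁ where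
  field
    irrefl     : ∀ α → ¬ (α < α)
    trans      : ∀ {α β γ} → α < β → β < γ → α < γ
    trichotomy : ∀ α β → (α < β) ⊎ ((α ≡ β) ⊎ (β < α))
    wellFounded : WellFounded _<_
    segmentsCountable : ∀ β → Countable (Σ Ω (λ α → α < β))
    uncountable : ¬ Countable Ω

module Omega1Defs (Ω : Set) (_<_ : Ω → Ω → Set) where

  Subset : Set₁
  Subset = Ω → Set

  Family : Set₁
  Family = Subset → Set

  record IsNormalIdeal (I : Family) : Set₁ where
    field
      downClosed : ∀ (X Y : Subset) → I X → (∀ α → Y α → X α) → I Y
      unionClosed : ∀ (X Y : Subset) → I X → I Y → I (λ α → X α ⊎ Y α)
      proper : ¬ I (λ _ → ⊤)
      singletons : ∀ β → I (λ α → α ≡ β)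
      diagonalUnion : ∀ (X : Ω → Subset) → (∀ α → I (X α)) →
        I (λ β → Σ Ω (λ α → (α < β) × X α β))

  Positive : Family → Subset → Set
  Positive J X = ¬ J X

  _↾_ : Family → Subset → Family
  (J ↾ A) X = J (λ α → A α × X α)

  ForallJ : Family → Subset → Set
  ForallJ J φ = J (λ α → ¬ φ α)

  ExistsJ : Family → Subset → Set
  ExistsJ J φ = ¬ J φ

  ExistsJIn : Family → Subset → Subset → Set
  ExistsJIn J C φ = ExistsJ J (λ α → C α × φ α)

  module Coloring {l : ℕ} (c : Ω → Ω → Fin l) where

    WeaklySaturated : Fin l → Fin l → Family → Subset → Subset → Set
    WeaklySaturated i j J C D =
      ExistsJIn J C (λ α → ExistsJIn J D (λ β → c α β ≡ i)) ×
      ExistsJIn J D (λ β → ExistsJIn J C (λ α → c α β ≡ j))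

    Saturated : Fin l → Fin l → Family → Subset → Subset → Set₁
    Saturated i j J A B =
      Positive J A × Positive J B ×
      (∀ (C D : Subset) → Positive J C → Positive J D →
        (∀ α → C α → A α) → (∀ β → D β → B β) →
        WeaklySaturated i j J C D)

    SaturatedPairOfNormalIdeals : Fin l → Fin l → Family → Family → Set₁
    SaturatedPairOfNormalIdeals i j J₀ J₁ =
      IsNormalIdeal J₀ × IsNormalIdeal J₁ ×
      (∀ (I₀ I₁ : Family) → IsNormalIdeal I₀ → IsNormalIdeal I₁ →
        (∀ X → J₀ X → I₀ X) → (∀ X → J₁ X → I₁ X) →
        ForallJ I₀ (λ α → ExistsJ I₁ (λ β → c α β ≡ i)) ×
        ForallJ I₁ (λ β → ExistsJ I₀ (λ α → c α β ≡ j)))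

-- A normal ideal containing the singletons contains every bounded subset of ω₁: fix an
-- injection g of the predecessors of α into ℕ; a limit β < α has a predecessor γ with
-- g β ≤ g γ, so every β < α is minimal or belongs to the diagonal union of the sets
-- {δ < α : g δ ≤ g γ} ∪ {γ + 1}, each of which is finite.
--
-- Given I₀ ⊇ J↾A and normal I₁ ⊇ J↾B, suppose the set C ⊆ A of those α with
-- {β : c(α,β) = i} ∈ I₁ were J-positive. Removing from B the diagonal union of these
-- sets leaves a set D that is J-positive, since I₁ is proper. For α ∈ C the β ∈ D with
-- c(α,β) = i are all ≤ α, hence form a set in J, contradicting saturation of ⟨C,D⟩.
-- The second half is the same argument with the roles of the two coordinates exchanged.
module Submission where

open import Defs
open import Data.Nat using (ℕ; zero; suc; z≤n; _≤_)
open import Data.Nat.Properties using (n≤0⇒n≡0; m≤n⇒m<n∨m≡n; ≤-pred; ≤∧≢⇒<)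
open import Data.Fin using (Fin)
open import Data.Product using (Σ; _×_; _,_; proj₁; proj₂)
open import Data.Sum using (_⊎_; inj₁; inj₂)
open import Data.Unit using (⊤; tt)
open import Data.Empty using (⊥; ⊥-elim)
open import Relation.Nullary using (¬_)
open import Relation.Binary.PropositionalEquality using (_≡_; refl; sym; trans; cong; subst)

module _ {Ω : Set} {_<_ : Ω → Ω → Set} where
  open Omega1Defs Ω _<_

  _⊆_ : Subset → Subset → Set
  X ⊆ Y = ∀ α → X α → Y α

  ∇ : (Ω → Subset) → Subset
  ∇ X β = Σ Ω (λ α → (α < β) × X α β)

  InjectiveOn : (Ω → ℕ) → Subset → Set
  InjectiveOn g P = ∀ δ ε → P δ → P ε → g δ ≡ g ε → δ ≡ ε

  IsMinimal : Subset
  IsMinimal β = ∀ γ → ¬ (γ < β)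

  IsSuccessorOf : Ω → Subset
  IsSuccessorOf γ β = (γ < β) × (∀ δ → γ < δ → ¬ (δ < β))

  IsLimit : Subset
  IsLimit β = Σ Ω (_< β) × (∀ γ → γ < β → Σ Ω (λ δ → (γ < δ) × (δ < β)))

  -- The diagonal union of the singletons is a member of I that does not require an element of Ω.
  ∅∈ : {I : Family} → IsNormalIdeal I → (X : Subset) → (∀ α → ¬ X α) → I X
  ∅∈ I-normal X empty =
    downClosed _ X (diagonalUnion (λ α β → β ≡ α) singletons) (λ α Xα → ⊥-elim (empty α Xα))
    where open IsNormalIdeal I-normal

  ↾-isNormalIdeal : {J : Family} → IsNormalIdeal J → {A : Subset} → Positive J A →
                    IsNormalIdeal (J ↾ A)
  ↾-isNormalIdeal J-normal {A} A-positive = record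
    { downClosed    = λ X Y A∩X∈J Y⊆X → downClosed _ _ A∩X∈J (λ α (Aα , Yα) → Aα , Y⊆X α Yα)
    ; unionClosed   = λ X Y A∩X∈J A∩Y∈J →
                        downClosed _ _ (unionClosed _ _ A∩X∈J A∩Y∈J) (λ α → distrib)
    ; proper        = λ A∈J → A-positive (downClosed _ _ A∈J (λ α Aα → Aα , tt))
    ; singletons    = λ β → downClosed _ _ (singletons β) (λ α → proj₂)
    ; diagonalUnion = λ X A∩X∈J → downClosed _ _ (diagonalUnion (λ α β → A β × X α β) A∩X∈J)
                        (λ β (Aβ , α , α<β , Xαβ) → α , α<β , Aβ , Xαβ)
    }
    where
    open IsNormalIdeal J-normal
    distrib : {P X Y : Set} → P × (X ⊎ Y) → (P × X) ⊎ (P × Y)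
    distrib (p , inj₁ x) = inj₁ (p , x)
    distrib (p , inj₂ y) = inj₂ (p , y)

  module _ (lem : ExcludedMiddle) (ω₁ : IsOmega1 Ω _<_) where
    open IsOmega1 ω₁ using (irrefl; trichotomy; segmentsCountable)
                     renaming (trans to <-trans)

    ¬¬-elim : {P : Set} → ¬ ¬ P → P
    ¬¬-elim {P} ¬¬p with lem P
    ... | inj₁ p  = p
    ... | inj₂ ¬p = ⊥-elim (¬¬p ¬p)

    minimal-or-successor-or-limit :
      ∀ β → IsMinimal β ⊎ (Σ Ω (λ γ → IsSuccessorOf γ β) ⊎ IsLimit β)
    minimal-or-successor-or-limit β with lem (Σ Ω (_< β))
    ... | inj₂ none = inj₁ (λ γ γ<β → none (γ , γ<β))
    ... | inj₁ some with lem (Σ Ω (λ γ → (γ < β) × ¬ Σ Ω (λ δ → (γ < δ) × (δ < β))))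
    ...   | inj₁ (γ , γ<β , gap) = inj₂ (inj₁ (γ , γ<β , λ δ γ<δ δ<β → gap (δ , γ<δ , δ<β)))
    ...   | inj₂ no-gap =
            inj₂ (inj₂ (some , λ γ γ<β → ¬¬-elim (λ gap → no-gap (γ , γ<β , gap))))

    segment-injection : ∀ α → Σ (Ω → ℕ) (λ g → InjectiveOn g (_< α))
    segment-injection α = g , g-injective
      where
      f : Σ Ω (_< α) → ℕ
      f = proj₁ (segmentsCountable α)

      g : Ω → ℕ
      g δ with lem (δ < α)
      ... | inj₁ δ<α = f (δ , δ<α)
      ... | inj₂ _   = 0

      g-extends-f : ∀ δ → δ < α → Σ (δ < α) (λ δ<α → g δ ≡ f (δ , δ<α))
      g-extends-f δ δ<α with lem (δ < α)
      ... | inj₁ δ<α′ = δ<α′ , refl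
      ... | inj₂ δ≮α  = ⊥-elim (δ≮α δ<α)

      g-injective : InjectiveOn g (_< α)
      g-injective δ ε δ<α ε<α gδ≡gε with g-extends-f δ δ<α | g-extends-f ε ε<α
      ... | _ , gδ≡fδ | _ , gε≡fε =
        cong proj₁ (proj₂ (segmentsCountable α) (trans (sym gδ≡fδ) (trans gδ≡gε gε≡fε)))

    -- Each value n of g is taken at most once below β, so it can be stepped over.
    eventually-above : (g : Ω → ℕ) (β : Ω) → InjectiveOn g (_< β) → Σ Ω (_< β) →
      ∀ n → Σ Ω (λ γ → (γ < β) × (∀ ε → γ < ε → ε < β → n ≤ g ε))
    eventually-above g β g-injective (γ₀ , γ₀<β) zero = γ₀ , γ₀<β , λ _ _ _ → z≤n
    eventually-above g β g-injective γ₀ (suc n)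
      with eventually-above g β g-injective γ₀ n
    ... | γ , γ<β , above-γ with lem (Σ Ω (λ δ → (γ < δ) × (δ < β) × (g δ ≡ n)))
    ...   | inj₂ none = γ , γ<β , λ ε γ<ε ε<β →
              ≤∧≢⇒< (above-γ ε γ<ε ε<β) (λ n≡gε → none (ε , γ<ε , ε<β , sym n≡gε))
    ...   | inj₁ (δ , γ<δ , δ<β , gδ≡n) = δ , δ<β , λ ε δ<ε ε<β →
              ≤∧≢⇒< (above-γ ε (<-trans γ<δ δ<ε) ε<β)
                    (λ n≡gε → irrefl ε (subst (_< ε)
                       (g-injective δ ε δ<β ε<β (trans gδ≡n n≡gε)) δ<ε))

    limit-unbounded : (g : Ω → ℕ) (β : Ω) → InjectiveOn g (_< β) → IsLimit β →
      ∀ n → Σ Ω (λ γ → (γ < β) × (n ≤ g γ))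
    limit-unbounded g β g-injective (nonempty , between) n
      with eventually-above g β g-injective nonempty n
    ... | γ , γ<β , above-γ with between γ γ<β
    ...   | δ , γ<δ , δ<β = δ , δ<β , above-γ δ γ<δ δ<β

    module _ {I : Family} (I-normal : IsNormalIdeal I) where
      open IsNormalIdeal I-normal

      subsingleton∈ : (X : Subset) → (∀ α β → X α → X β → α ≡ β) → I X
      subsingleton∈ X unique with lem (Σ Ω X)
      ... | inj₁ (α , Xα) = downClosed _ X (singletons α) (λ β Xβ → unique β α Xβ Xα)
      ... | inj₂ none     = ∅∈ I-normal X (λ α Xα → none (α , Xα))

      fibre∈ : (P : Subset) (g : Ω → ℕ) → InjectiveOn g P → ∀ n → I (λ β → P β × (g β ≡ n))
      fibre∈ P g g-injective n = subsingleton∈ _ (λ α β (Pα , gα≡n) (Pβ , gβ≡n) →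
                                   g-injective α β Pα Pβ (trans gα≡n (sym gβ≡n)))

      bounded-values∈ : (P : Subset) (g : Ω → ℕ) → InjectiveOn g P →
                        ∀ n → I (λ β → P β × (g β ≤ n))
      bounded-values∈ P g g-injective zero =
        downClosed _ _ (fibre∈ P g g-injective zero) (λ β (Pβ , gβ≤0) → Pβ , n≤0⇒n≡0 gβ≤0)
      bounded-values∈ P g g-injective (suc n) =
        downClosed _ _ (unionClosed _ _ (bounded-values∈ P g g-injective n)
                                        (fibre∈ P g g-injective (suc n)))
                       split
        where
        split : ∀ β → P β × (g β ≤ suc n) → (P β × (g β ≤ n)) ⊎ (P β × (g β ≡ suc n))
        split β (Pβ , gβ≤1+n) with m≤n⇒m<n∨m≡n gβ≤1+n
        ... | inj₁ gβ<1+n = inj₁ (Pβ , ≤-pred gβ<1+n)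
        ... | inj₂ gβ≡1+n = inj₂ (Pβ , gβ≡1+n)

      minimals∈ : I IsMinimal
      minimals∈ = subsingleton∈ _ unique
        where
        unique : ∀ α β → IsMinimal α → IsMinimal β → α ≡ β
        unique α β min-α min-β with trichotomy α β
        ... | inj₁ α<β         = ⊥-elim (min-β α α<β)
        ... | inj₂ (inj₁ α≡β) = α≡β
        ... | inj₂ (inj₂ β<α) = ⊥-elim (min-α β β<α)

      successors∈ : ∀ γ → I (IsSuccessorOf γ)
      successors∈ γ = subsingleton∈ _ unique
        where
        unique : ∀ α β → IsSuccessorOf γ α → IsSuccessorOf γ β → α ≡ β
        unique α β (γ<α , gap-α) (γ<β , gap-β) with trichotomy α β
        ... | inj₁ α<β         = ⊥-elim (gap-β α γ<α α<β)
        ... | inj₂ (inj₁ α≡β) = α≡β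
        ... | inj₂ (inj₂ β<α) = ⊥-elim (gap-α β γ<β β<α)

      initialSegment∈ : ∀ α → I (_< α)
      initialSegment∈ α =
        downClosed _ _ (unionClosed _ _ minimals∈ (diagonalUnion X X∈)) covered
        where
        g : Ω → ℕ
        g = proj₁ (segment-injection α)

        g-injective : InjectiveOn g (_< α)
        g-injective = proj₂ (segment-injection α)

        X : Ω → Subset
        X γ β = ((β < α) × (g β ≤ g γ)) ⊎ IsSuccessorOf γ β

        X∈ : ∀ γ → I (X γ)
        X∈ γ = unionClosed _ _ (bounded-values∈ (_< α) g g-injective (g γ)) (successors∈ γ)

        covered : ∀ β → β < α → IsMinimal β ⊎ ∇ X β
        covered β β<α with minimal-or-successor-or-limit β
        ... | inj₁ minimal                      = inj₁ minimal
        ... | inj₂ (inj₁ (γ , γ<β , gap))       = inj₂ (γ , γ<β , inj₂ (γ<β , gap))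
        ... | inj₂ (inj₂ limit)
          with limit-unbounded g β
                 (λ δ ε δ<β ε<β → g-injective δ ε (<-trans δ<β β<α) (<-trans ε<β β<α))
                 limit (g β)
        ...   | γ , γ<β , gβ≤gγ = inj₂ (γ , γ<β , inj₁ (β<α , gβ≤gγ))

      closedSegment∈ : ∀ α → I (λ β → (β < α) ⊎ (β ≡ α))
      closedSegment∈ α = unionClosed _ _ (initialSegment∈ α) (singletons α)

    saturated⇒∀∃ : {J I₀ I₁ : Family} → IsNormalIdeal J → IsNormalIdeal I₁ →
      {A B : Subset} → (∀ X → (J ↾ A) X → I₀ X) → (∀ X → (J ↾ B) X → I₁ X) →
      (R : Ω → Ω → Set) →
      (∀ C D → Positive J C → Positive J D → C ⊆ A → D ⊆ B →
         ExistsJIn J C (λ α → ExistsJIn J D (R α))) →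
      ForallJ I₀ (λ α → ExistsJ I₁ (R α))
    saturated⇒∀∃ {J} {I₀} {I₁} J-normal I₁-normal {A} {B} J↾A⊆I₀ J↾B⊆I₁ R saturated =
      ¬¬-elim refute
      where
      module J′ = IsNormalIdeal J-normal
      module I₁′ = IsNormalIdeal I₁-normal

      Bad : Subset
      Bad α = ¬ ExistsJ I₁ (R α)

      refute : ¬ I₀ Bad → ⊥
      refute Bad∉I₀ = saturated C D C-positive D-positive (λ _ → proj₁) (λ _ → proj₁) fibres∈J
        where
        C : Subset
        C α = A α × Bad α

        C-positive : Positive J C
        C-positive C∈J = Bad∉I₀ (J↾A⊆I₀ Bad C∈J)

        Y : Ω → Subset
        Y α β = Bad α × R α β

        Y∈ : ∀ α → I₁ (Y α)
        Y∈ α with lem (I₁ (R α))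
        ... | inj₁ Rα∈I₁ = I₁′.downClosed _ _ Rα∈I₁ (λ _ → proj₂)
        ... | inj₂ Rα∉I₁ = ∅∈ I₁-normal (Y α) (λ β (bad , _) → bad Rα∉I₁)

        D : Subset
        D β = B β × ¬ ∇ Y β

        D-positive : Positive J D
        D-positive D∈J =
          I₁′.proper (I₁′.downClosed _ _ (I₁′.unionClosed _ _ D∪∇Y∈I₁ ∁B∈I₁) covered)
          where
          D∪∇Y∈I₁ : I₁ (λ β → D β ⊎ ∇ Y β)
          D∪∇Y∈I₁ = I₁′.unionClosed _ _ (J↾B⊆I₁ D (J′.downClosed _ _ D∈J (λ _ → proj₂)))
                                        (I₁′.diagonalUnion Y Y∈)
          ∁B∈I₁ : I₁ (λ β → ¬ B β)
          ∁B∈I₁ = J↾B⊆I₁ _ (∅∈ J-normal _ (λ β (Bβ , ¬Bβ) → ¬Bβ Bβ))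
          covered : ∀ β → ⊤ → (D β ⊎ ∇ Y β) ⊎ ¬ B β
          covered β _ with lem (B β) | lem (∇ Y β)
          ... | inj₂ ¬Bβ | _       = inj₂ ¬Bβ
          ... | inj₁ Bβ  | inj₁ ∇Yβ = inj₁ (inj₂ ∇Yβ)
          ... | inj₁ Bβ  | inj₂ ¬∇Yβ = inj₁ (inj₁ (Bβ , ¬∇Yβ))

        fibres∈J : J (λ α → C α × ExistsJIn J D (R α))
        fibres∈J = ∅∈ J-normal _ (λ α (Cα , fibre∉J) →
          fibre∉J (J′.downClosed _ _ (closedSegment∈ J-normal α) (below α Cα)))
          where
          below : ∀ α → C α → ∀ β → D β × R α β → (β < α) ⊎ (β ≡ α)
          below α (_ , bad) β ((_ , ¬∇Yβ) , Rαβ) with trichotomy α β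
          ... | inj₁ α<β         = ⊥-elim (¬∇Yβ (α , α<β , bad , Rαβ))
          ... | inj₂ (inj₁ α≡β) = inj₂ (sym α≡β)
          ... | inj₂ (inj₂ β<α) = inj₁ β<α

mainTheorem4 : ExcludedMiddle →
    (Ω : Set) (_<_ : Ω → Ω → Set) → IsOmega1 Ω _<_ →
    (l : ℕ) (c : Ω → Ω → Fin l) → (∀ α β → c α β ≡ c β α) →
    (J : Omega1Defs.Family Ω _<_) → Omega1Defs.IsNormalIdeal Ω _<_ J →
    (i j : Fin l) (A B : Omega1Defs.Subset Ω _<_) →
    Omega1Defs.Coloring.Saturated Ω _<_ c i j J A B →
    Omega1Defs.Coloring.SaturatedPairOfNormalIdeals Ω _<_ c i j
    (Omega1Defs._↾_ Ω _<_ J A) (Omega1Defs._↾_ Ω _<_ J B)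
mainTheorem4 lem Ω _<_ ω₁ _ c _ J J-normal i j A B (A-positive , B-positive , saturated) =
  ↾-isNormalIdeal J-normal A-positive , ↾-isNormalIdeal J-normal B-positive ,
  λ I₀ I₁ I₀-normal I₁-normal J↾A⊆I₀ J↾B⊆I₁ →
    saturated⇒∀∃ lem ω₁ J-normal I₁-normal J↾A⊆I₀ J↾B⊆I₁ (λ α β → c α β ≡ i)
      (λ C D C⁺ D⁺ C⊆A D⊆B → proj₁ (saturated C D C⁺ D⁺ C⊆A D⊆B)) ,
    saturated⇒∀∃ lem ω₁ J-normal I₀-normal J↾B⊆I₁ J↾A⊆I₀ (λ β α → c α β ≡ j)
      (λ D C D⁺ C⁺ D⊆B C⊆A → proj₂ (saturated C D C⁺ D⁺ C⊆A D⊆B))
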